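{- Let $\mathbb{F}_q$ be a finite field of order $q=p^s$ with $p$ prime. Let $P_1,\dots,P_r \in \mathbb{F}_q[t_1,\dots,t_n]$ be nonzero polynomials, let $f_1,\dots,f_n \in \mathbb{F}_q[t]$ be any polynomials, and let $\mathcal{I}\subseteq\{1,\dots,n\}$ be a nonempty subset. Suppose that \[ (q-1) \sum_{j=1}^r \deg_{\mathcal{I}}(P_j) < \sum_{i\in\mathcal{I}} u(f_i). \] Then $p$ divides $\# \{ (x_1,\dots,x_n) \in \mathbb{F}_q^n \mid P_j(f_1(x_1),\ldots,f_n(x_n)) = 0 \text{ for all } 1 \leq j \leq r\}$.
   Context: For $f \in \mathbb{F}_q[t]$, $u(f)$ denotes the least positive integer $\delta$ such that $\sum_{x \in \mathbb{F}_q} f(x)^{\delta} \neq 0$ if such $\delta$ exists, and $u(f)=\infty$ otherwise (with the convention $0^0=1$). For nonempty $\mathcal{I}\subseteq\{1,\dots,n\}$ and a monomial $a t_1^{m_1}\cdots t_n^{m_n}$ with $a\neq 0$, its $\mathcal{I}$-degree is $\sum_{i\in\mathcal{I}} m_i$; for $P\in\mathbb{F}_q[t_1,\dots,t_n]$, $\deg_{\mathcal{I}}(P)$ is the maximum of the $\mathcal{I}$-degrees of its monomial terms (and $\deg_{\mathcal{I}}(0)=-\infty$). -}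

module Defs where

open import Level using (Level) renaming (suc to lsuc; _⊔_ to _⊔ℓ_)
open import Data.Nat as ℕ using (ℕ; zero; suc; _⊔_)
open import Data.Fin as Fin using (Fin)
open import Data.Bool using (Bool; true; false; if_then_else_; _∧_)
open import Data.Fin.Subset using (Subset; inside; outside)
open import Data.Vec as Vec using (Vec; []; _∷_)
open import Data.List as List using (List; []; _∷_)
open import Data.List.Relation.Unary.All using (All)
open import Data.List.Relation.Unary.Unique.Propositional using (Unique)
open import Data.Product using (_×_; _,_; proj₁; proj₂; ∃)
open import Data.Unit using (⊤)
open import Relation.Nullary using (¬_; Dec; yes; no)
open import Relation.Binary.PropositionalEquality using (_≡_)
open import Algebra.Bundles using (CommutativeRing)

record FiniteField (c ℓ : Level) (q : ℕ) : Set (lsuc (c ⊔ℓ ℓ)) where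
  field
    commRing : CommutativeRing c ℓ
  open CommutativeRing commRing public
  field
    1≉0     : ¬ (1# ≈ 0#)
    inverse : ∀ x → ¬ (x ≈ 0#) → ∃ λ y → x * y ≈ 1#
    _≟_     : (x y : Carrier) → Dec (x ≈ y)
    enum    : Fin q → Carrier
    enum-injective  : ∀ i j → enum i ≈ enum j → i ≡ j
    enum-surjective : ∀ x → ∃ λ i → enum i ≈ x

data ℕ∞ : Set where
  fin : ℕ → ℕ∞
  ∞   : ℕ∞

degIMono : ∀ {n} → Subset n → Vec ℕ n → ℕ
degIMono []       []       = 0
degIMono (b ∷ bs) (m ∷ ms) = (if b then m else 0) ℕ.+ degIMono bs ms


sumFin : ∀ r → (Fin r → ℕ) → ℕ
sumFin zero    g = 0
sumFin (suc r) g = g Fin.zero ℕ.+ sumFin r (λ j → g (Fin.suc j))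

_+∞_ : ℕ∞ → ℕ∞ → ℕ∞
fin a +∞ fin b = fin (a ℕ.+ b)
fin a +∞ ∞     = ∞
∞     +∞ _     = ∞

sumUI : ∀ {n} → Subset n → Vec ℕ∞ n → ℕ∞
sumUI []       []       = fin 0
sumUI (b ∷ bs) (u ∷ us) = (if b then u else fin 0) +∞ sumUI bs us

infix 4 _<∞_
_<∞_ : ℕ → ℕ∞ → Set
a <∞ fin b = a ℕ.< b
a <∞ ∞     = ⊤

module _ {c ℓ : Level} {q : ℕ} (F : FiniteField c ℓ q) where
  open FiniteField F

  -- x ^ k, with x ^ 0 = 1 (in particular 0 ^ 0 = 1)
  pow : Carrier → ℕ → Carrier
  pow x zero    = 1#
  pow x (suc k) = x * pow x k

  sumF : (Carrier → Carrier) → Carrier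
  sumF g = List.foldr (λ k acc → g (enum k) + acc) 0# (List.allFin q)

  -- Univariate polynomials in F_q[t], as dense coefficient lists
  -- (constant coefficient first).
  UPoly : Set c
  UPoly = List Carrier

  evalU : UPoly → Carrier → Carrier
  evalU []       x = 0#
  evalU (a ∷ as) x = a + x * evalU as x

  record MPoly (n : ℕ) : Set (c ⊔ℓ ℓ) where
    field
      terms    : List (Carrier × Vec ℕ n)
      distinct : Unique (List.map proj₂ terms)
      nonzeroC : All (λ t → ¬ (proj₁ t ≈ 0#)) terms
  open MPoly public

  NonzeroPoly : ∀ {n} → MPoly n → Set c
  NonzeroPoly P = ¬ (terms P ≡ [])

  monomial : ∀ {n} → Vec ℕ n → Vec Carrier n → Carrier
  monomial []       []       = 1#
  monomial (m ∷ ms) (x ∷ xs) = pow x m * monomial ms xs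

  evalM : ∀ {n} → MPoly n → Vec Carrier n → Carrier
  evalM P xs = List.foldr (λ t acc → proj₁ t * monomial (proj₂ t) xs + acc) 0# (terms P)

  -- u(f): least δ ≥ 1 with Σ_x f(x)^δ ≠ 0, or ∞.  Expressed as a relation
  -- IsU f u between f and its (unique) value u ∈ ℕ ∪ {∞}.

  PowerSum : UPoly → ℕ → Carrier
  PowerSum f δ = sumF (λ x → pow (evalU f x) δ)

  IsU : UPoly → ℕ∞ → Set ℓ
  IsU f (fin δ) = (1 ℕ.≤ δ) × ¬ (PowerSum f δ ≈ 0#)
                × (∀ δ′ → 1 ℕ.≤ δ′ → δ′ ℕ.< δ → PowerSum f δ′ ≈ 0#)
  IsU f ∞       = ∀ δ → 1 ℕ.≤ δ → PowerSum f δ ≈ 0#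

  allVecs : (n : ℕ) → List (Vec (Fin q) n)
  allVecs zero    = [] ∷ []
  allVecs (suc n) = List.concatMap (λ k → List.map (k ∷_) (allVecs n)) (List.allFin q)

  allZero : ∀ {r} → (Fin r → Carrier) → Bool
  allZero {zero}  v = true
  allZero {suc r} v with v Fin.zero ≟ 0#
  ... | yes _ = allZero (λ j → v (Fin.suc j))
  ... | no  _ = false

  countZeros : ∀ {n r} → (Fin r → MPoly n) → Vec UPoly n → ℕ
  countZeros {n} Ps fs =
    List.length (List.filterᵇ
      (λ k → allZero (λ j → evalM (Ps j) (Vec.zipWith (λ f x → evalU f (enum x)) fs k)))
      (allVecs n))

  degI : ∀ {n} → Subset n → MPoly n → ℕ
  degI I P = List.foldr (λ t acc → degIMono I (proj₂ t) ⊔ acc) 0 (terms P)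

{-# OPTIONS --safe #-}
module Submission where

-- Warning's argument with the exponent weighted by u(f_i).  Let e be the number
-- of units of F, so that a ^ e = 1 for every unit a and 1 ≤ e ≤ q - 1.  The
-- polynomial G = ∏_j (1 - P_j ^ e) is the indicator of the common zeros of the
-- P_j, so the number N of zeros satisfies N · 1 = Σ_x G(f_1(x_1), …, f_n(x_n)).
-- Expanding G into monomials, each sum over the grid factors into power sums
-- Σ_x f_i(x) ^ m_i, and a monomial of I-degree ≤ e · Σ_j deg_I P_j < Σ_{i ∈ I} u(f_i)
-- has some m_i < u(f_i) with i ∈ I, so its power sum vanishes.  Hence N · 1 = 0
-- in F, and since the characteristic of F is p, p divides N.

open import Defs
open import Level using (Level)
open import Algebra.Bundles using (CommutativeMonoid; Semiring)
open import Data.Bool using (Bool; true; false; if_then_else_)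
open import Data.Empty using (⊥-elim)
open import Data.Fin using (Fin; zero; suc)
open import Data.Fin.Permutation using (Permutation′; _⟨$⟩ʳ_; permutation)
open import Data.Fin.Subset using (Subset; Nonempty)
open import Data.List as List using (List; []; _∷_; _++_)
open import Data.List.Membership.Propositional.Properties using (∈-allFin)
open import Data.List.Relation.Unary.All as All using (All; []; _∷_)
import Data.List.Relation.Unary.All.Properties as All
import Data.List.Relation.Unary.Any as Any
import Data.List.Properties as List
open import Data.Nat as ℕ using (ℕ; zero; suc; _≤_; _<_; z≤n; s≤s)
import Data.Nat.Properties as ℕ
open import Data.Nat.Divisibility using (_∣_)
open import Algebra.Properties.CommutativeSemigroup ℕ.+-commutativeSemigroup
  using () renaming (interchange to +-interchange)
open import Data.Nat.GCD using (gcd-GCD; gcd[m,n]∣m; gcd[m,n]∣n; module Bézout)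
open import Data.Nat.Primality using (Prime; prime⇒irreducible)
open import Data.Product as Prod using (_,_; proj₁; proj₂)
open import Data.Sum using (_⊎_; inj₁; inj₂)
open import Data.Unit using (tt)
open import Data.Vec as Vec using (Vec; []; _∷_; lookup)
open import Function using (_∘_)
open import Relation.Nullary using (¬_; Dec; yes; no; ¬?)
open import Relation.Binary.PropositionalEquality as ≡ using (_≡_)

module ListSum {a ℓ} (M : CommutativeMonoid a ℓ) where
  open CommutativeMonoid M
  open import Algebra.Definitions.RawMonoid rawMonoid using (_×_)
  open import Algebra.Properties.CommutativeSemigroup commutativeSemigroup using (interchange)
  open import Algebra.Properties.CommutativeMonoid.Sum M using (sum; sum-permute)
  open import Relation.Binary.Reasoning.Setoid setoid

  private variable
    b b′ : Level
    A : Set b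
    B : Set b′

  sumOver : List A → (A → Carrier) → Carrier
  sumOver xs f = List.foldr (λ x acc → f x ∙ acc) ε xs

  sumOver-cong : ∀ (xs : List A) {f g : A → Carrier} → (∀ x → f x ≈ g x) → sumOver xs f ≈ sumOver xs g
  sumOver-cong []       f≈g = refl
  sumOver-cong (x ∷ xs) f≈g = ∙-cong (f≈g x) (sumOver-cong xs f≈g)

  sumOver-++ : ∀ (xs ys : List A) f → sumOver (xs ++ ys) f ≈ sumOver xs f ∙ sumOver ys f
  sumOver-++ []       ys f = sym (identityˡ _)
  sumOver-++ (x ∷ xs) ys f = trans (∙-congˡ (sumOver-++ xs ys f)) (sym (assoc _ _ _))

  sumOver-map : ∀ (g : A → B) xs f → sumOver (List.map g xs) f ≡ sumOver xs (f ∘ g)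
  sumOver-map g []       f = ≡.refl
  sumOver-map g (x ∷ xs) f = ≡.cong (f (g x) ∙_) (sumOver-map g xs f)

  sumOver-concatMap : ∀ (g : A → List B) xs f →
                      sumOver (List.concatMap g xs) f ≈ sumOver xs (λ x → sumOver (g x) f)
  sumOver-concatMap g []       f = refl
  sumOver-concatMap g (x ∷ xs) f = trans (sumOver-++ (g x) _ f) (∙-congˡ (sumOver-concatMap g xs f))

  sumOver-∙ : ∀ (xs : List A) f g → sumOver xs (λ x → f x ∙ g x) ≈ sumOver xs f ∙ sumOver xs g
  sumOver-∙ []       f g = sym (identityˡ _)
  sumOver-∙ (x ∷ xs) f g = trans (∙-congˡ (sumOver-∙ xs f g)) (interchange _ _ _ _)

  sumOver-ε : ∀ (xs : List A) {f} → All (λ x → f x ≈ ε) xs → sumOver xs f ≈ ε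
  sumOver-ε []       []         = refl
  sumOver-ε (x ∷ xs) (fx≈ε ∷ p) = trans (∙-cong fx≈ε (sumOver-ε xs p)) (identityˡ ε)

  sumOver-comm : ∀ (xs : List A) (ys : List B) (f : A → B → Carrier) →
                 sumOver xs (λ x → sumOver ys (f x)) ≈ sumOver ys (λ y → sumOver xs (λ x → f x y))
  sumOver-comm []       ys f = sym (sumOver-ε ys {λ _ → ε} (All.tabulate (λ _ → refl)))
  sumOver-comm (x ∷ xs) ys f = begin
    sumOver ys (f x) ∙ sumOver xs (λ x → sumOver ys (f x))  ≈⟨ ∙-congˡ (sumOver-comm xs ys f) ⟩
    sumOver ys (f x) ∙ sumOver ys (λ y → sumOver xs (λ x → f x y))
      ≈⟨ sym (sumOver-∙ ys (f x) _) ⟩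
    sumOver ys (λ y → f x y ∙ sumOver xs (λ x → f x y))     ∎

  sumOver-const : ∀ (xs : List A) x → sumOver xs (λ _ → x) ≡ List.length xs × x
  sumOver-const []       x = ≡.refl
  sumOver-const (_ ∷ xs) x = ≡.cong (x ∙_) (sumOver-const xs x)

  length-filterᵇ-× : ∀ (p : A → Bool) xs x →
                     List.length (List.filterᵇ p xs) × x ≈ sumOver xs (λ y → if p y then x else ε)
  length-filterᵇ-× p []       x = refl
  length-filterᵇ-× p (y ∷ xs) x with p y
  ... | true  = ∙-congˡ (length-filterᵇ-× p xs x)
  ... | false = trans (length-filterᵇ-× p xs x) (sym (identityˡ _))

  sumOver-tabulate : ∀ {n} (g : Fin n → A) f → sumOver (List.tabulate g) f ≡ sum (f ∘ g)
  sumOver-tabulate {n = zero}  g f = ≡.refl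
  sumOver-tabulate {n = suc n} g f = ≡.cong (f (g zero) ∙_) (sumOver-tabulate (g ∘ suc) f)

  sumOver-allFin-permute : ∀ {n} (π : Permutation′ n) f →
                           sumOver (List.allFin n) (f ∘ (π ⟨$⟩ʳ_)) ≈ sumOver (List.allFin n) f
  sumOver-allFin-permute π f = begin
    sumOver (List.allFin _) (f ∘ (π ⟨$⟩ʳ_)) ≡⟨ sumOver-tabulate (λ i → i) (f ∘ (π ⟨$⟩ʳ_)) ⟩
    sum (f ∘ (π ⟨$⟩ʳ_))                     ≈⟨ sum-permute f π ⟨
    sum f                                    ≡⟨ sumOver-tabulate (λ i → i) f ⟨
    sumOver (List.allFin _) f                ∎

module SemiringSum {a ℓ} (R : Semiring a ℓ) where
  open Semiring R
  open ListSum +-commutativeMonoid public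

  private variable
    b : Level
    A : Set b

  sumOver-*ˡ : ∀ (xs : List A) x f → sumOver xs (λ y → x * f y) ≈ x * sumOver xs f
  sumOver-*ˡ []       x f = sym (zeroʳ x)
  sumOver-*ˡ (y ∷ xs) x f = trans (+-congˡ (sumOver-*ˡ xs x f)) (sym (distribˡ _ _ _))

  sumOver-*ʳ : ∀ (xs : List A) x f → sumOver xs (λ y → f y * x) ≈ sumOver xs f * x
  sumOver-*ʳ []       x f = sym (zeroˡ x)
  sumOver-*ʳ (y ∷ xs) x f = trans (+-congˡ (sumOver-*ʳ xs x f)) (sym (distribʳ _ _ _))

+∞-<∞-split : ∀ a d u U → a ℕ.+ d <∞ u +∞ U → a <∞ u ⊎ d <∞ U
+∞-<∞-split a d ∞       U       _ = inj₁ tt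
+∞-<∞-split a d (fin x) ∞       _ = inj₂ tt
+∞-<∞-split a d (fin x) (fin y) a+d<x+y with a ℕ.<? x | d ℕ.<? y
... | yes a<x | _       = inj₁ a<x
... | no  _   | yes d<y = inj₂ d<y
... | no  a≮x | no  d≮y = ⊥-elim (ℕ.<⇒≱ a+d<x+y (ℕ.+-mono-≤ (ℕ.≮⇒≥ a≮x) (ℕ.≮⇒≥ d≮y)))

≤-<∞-trans : ∀ {a b} U → a ≤ b → b <∞ U → a <∞ U
≤-<∞-trans (fin x) a≤b b<x = ℕ.≤-<-trans a≤b b<x
≤-<∞-trans ∞       _   _   = tt

degIMono-zipWith-+ : ∀ {n} (I : Subset n) m m′ →
                     degIMono I (Vec.zipWith ℕ._+_ m m′) ≡ degIMono I m ℕ.+ degIMono I m′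
degIMono-zipWith-+ []          []      []         = ≡.refl
degIMono-zipWith-+ (true ∷ I)  (i ∷ m) (j ∷ m′) =
  ≡.trans (≡.cong (i ℕ.+ j ℕ.+_) (degIMono-zipWith-+ I m m′)) (+-interchange i j _ _)
degIMono-zipWith-+ (false ∷ I) (_ ∷ m) (_ ∷ m′) = degIMono-zipWith-+ I m m′

degIMono-replicate-0 : ∀ {n} (I : Subset n) → degIMono I (Vec.replicate n 0) ≡ 0
degIMono-replicate-0 []          = ≡.refl
degIMono-replicate-0 (true ∷ I)  = degIMono-replicate-0 I
degIMono-replicate-0 (false ∷ I) = degIMono-replicate-0 I

module Counting {c ℓ : Level} {q : ℕ} (F : FiniteField c ℓ q) where
  open FiniteField F hiding (zero)
  open SemiringSum semiring
  open ListSum *-commutativeMonoid using () renaming (sumOver to productOver)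
  open import Algebra.Definitions.RawMonoid *-rawMonoid using () renaming (sum to ∏)
  open import Algebra.Definitions.RawSemiring (Semiring.rawSemiring semiring) using (_^_; _×_)
  open import Algebra.Properties.Ring ring using (-‿distribˡ-*; -‿+-comm; -0#≈0#; +-identityʳ-unique)
  open import Algebra.Properties.Semiring.Exp semiring using (^-congˡ; ^-congʳ; ^-homo-*)
  open import Algebra.Properties.Semiring.Mult semiring using (×-homo-+; ×1-homo-*)
  open import Algebra.Properties.CommutativeSemigroup *-commutativeSemigroup
    using () renaming (interchange to *-interchange)
  open import Relation.Binary.Reasoning.Setoid setoid

  *-cancelˡ : ∀ {x y z} → ¬ x ≈ 0# → x * y ≈ x * z → y ≈ z
  *-cancelˡ {x} {y} {z} x≉0 xy≈xz with inverse x x≉0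
  ... | x⁻¹ , xx⁻¹≈1 = begin
    y              ≈⟨ *-identityˡ y ⟨
    1# * y         ≈⟨ *-congʳ (trans (*-comm _ _) xx⁻¹≈1) ⟨
    x⁻¹ * x * y    ≈⟨ *-assoc _ _ _ ⟩
    x⁻¹ * (x * y)  ≈⟨ *-congˡ xy≈xz ⟩
    x⁻¹ * (x * z)  ≈⟨ *-assoc _ _ _ ⟨
    x⁻¹ * x * z    ≈⟨ *-congʳ (trans (*-comm _ _) xx⁻¹≈1) ⟩
    1# * z         ≈⟨ *-identityˡ z ⟩
    z              ∎

  zero-product : ∀ {x y} → x * y ≈ 0# → ¬ x ≈ 0# → y ≈ 0#
  zero-product xy≈0 x≉0 = *-cancelˡ x≉0 (trans xy≈0 (sym (zeroʳ _)))

  ^≈0⇒≈0 : ∀ {x} s → x ^ s ≈ 0# → x ≈ 0#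
  ^≈0⇒≈0         zero    1≈0    = ⊥-elim (1≉0 1≈0)
  ^≈0⇒≈0 {x} (suc s) xxˢ≈0 with x ≟ 0#
  ... | yes x≈0 = x≈0
  ... | no  x≉0 = ^≈0⇒≈0 s (zero-product xxˢ≈0 x≉0)

  pow≡^ : ∀ x k → pow F x k ≡ x ^ k
  pow≡^ x zero    = ≡.refl
  pow≡^ x (suc k) = ≡.cong (x *_) (pow≡^ x k)

  pow-homo-+ : ∀ x m n → pow F x (m ℕ.+ n) ≈ pow F x m * pow F x n
  pow-homo-+ x m n rewrite pow≡^ x (m ℕ.+ n) | pow≡^ x m | pow≡^ x n = ^-homo-* x m n

  module Reindex {a ℓ′} (M : CommutativeMonoid a ℓ′) (h h⁻¹ : Carrier → Carrier)
                 (h-cong : ∀ {x y} → x ≈ y → h x ≈ h y) (h⁻¹-cong : ∀ {x y} → x ≈ y → h⁻¹ x ≈ h⁻¹ y)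
                 (h∘h⁻¹ : ∀ x → h (h⁻¹ x) ≈ x) (h⁻¹∘h : ∀ x → h⁻¹ (h x) ≈ x) where

    module M′ where
      open CommutativeMonoid M public
      open ListSum M public

    index : (Carrier → Carrier) → Fin q → Fin q
    index g k = proj₁ (enum-surjective (g (enum k)))

    enum-index : ∀ g k → enum (index g k) ≈ g (enum k)
    enum-index g k = proj₂ (enum-surjective (g (enum k)))

    π : Permutation′ q
    π = permutation (index h) (index h⁻¹)
      (λ k → enum-injective _ _ (trans (enum-index h _) (trans (h-cong (enum-index h⁻¹ k)) (h∘h⁻¹ _))))
      (λ k → enum-injective _ _ (trans (enum-index h⁻¹ _) (trans (h⁻¹-cong (enum-index h k)) (h⁻¹∘h _))))

    sumOver-reindex : ∀ (g : Carrier → M′.Carrier) → (∀ {x y} → x ≈ y → g x M′.≈ g y) →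
                      M′.sumOver (List.allFin q) (g ∘ h ∘ enum) M′.≈ M′.sumOver (List.allFin q) (g ∘ enum)
    sumOver-reindex g g-cong = M′.trans
      (M′.sumOver-cong (List.allFin q) (λ k → g-cong (sym (enum-index h k))))
      (M′.sumOver-allFin-permute π (g ∘ enum))

  length-allFin : List.length (List.allFin q) ≡ q
  length-allFin = List.length-tabulate {n = q} (λ i → i)

  -- x ↦ x + 1 permutes F, so Σ x = Σ (x + 1) = Σ x + q · 1.
  q×1≈0 : q × 1# ≈ 0#
  q×1≈0 = +-identityʳ-unique X (q × 1#) (begin
    X + q × 1#                                ≡⟨ ≡.cong (λ n → X + n × 1#) length-allFin ⟨
    X + List.length (List.allFin q) × 1#      ≡⟨ ≡.cong (X +_) (sumOver-const (List.allFin q) 1#) ⟨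
    X + sumOver (List.allFin q) (λ _ → 1#)    ≈⟨ sumOver-∙ (List.allFin q) enum (λ _ → 1#) ⟨
    sumOver (List.allFin q) (λ k → enum k + 1#) ≈⟨ Translate.sumOver-reindex (λ x → x) (λ x≈y → x≈y) ⟩
    X                                         ∎)
    where
      X : Carrier
      X = sumOver (List.allFin q) enum

      module Translate = Reindex +-commutativeMonoid (_+ 1#) (_+ - 1#) +-congʳ +-congʳ
        (λ x → trans (+-assoc _ _ _) (trans (+-congˡ (-‿inverseˡ 1#)) (+-identityʳ x)))
        (λ x → trans (+-assoc _ _ _) (trans (+-congˡ (-‿inverseʳ 1#)) (+-identityʳ x)))

  isUnit? : (k : Fin q) → Dec (¬ enum k ≈ 0#)
  isUnit? k = ¬? (enum k ≟ 0#)

  -- The exponent e in Fermat's little theorem below; only 1 ≤ e ≤ q - 1 is used.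
  unitCount : ℕ
  unitCount = List.length (List.filter isUnit? (List.allFin q))

  0<unitCount : 0 < unitCount
  0<unitCount with enum-surjective 1#
  ... | k , k↦1 = List.filter-some isUnit?
    (Any.map (λ { ≡.refl k↦0 → 1≉0 (trans (sym k↦1) k↦0) }) (∈-allFin k))

  unitCount≤q∸1 : unitCount ≤ q ℕ.∸ 1
  unitCount≤q∸1 with enum-surjective 0#
  ... | k , k↦0 = ℕ.∸-monoˡ-≤ 1 (≡.subst (unitCount <_) length-allFin
    (List.filter-notAll isUnit? (List.allFin q) (Any.map (λ { ≡.refl k≉0 → k≉0 k↦0 }) (∈-allFin k))))

  -- The product of all units is invariant under x ↦ a x, which forces a ^ e = 1;
  -- unitOrOne lets that product range over all of F.
  unitOrOne : Carrier → Carrier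
  unitOrOne x with x ≟ 0#
  ... | yes _ = 1#
  ... | no  _ = x

  unitOrOne-zero : ∀ {x} → x ≈ 0# → unitOrOne x ≈ 1#
  unitOrOne-zero {x} x≈0 with x ≟ 0#
  ... | yes _   = refl
  ... | no  x≉0 = ⊥-elim (x≉0 x≈0)

  unitOrOne-unit : ∀ {x} → ¬ x ≈ 0# → unitOrOne x ≈ x
  unitOrOne-unit {x} x≉0 with x ≟ 0#
  ... | yes x≈0 = ⊥-elim (x≉0 x≈0)
  ... | no  _   = refl

  unitOrOne≉0 : ∀ x → ¬ unitOrOne x ≈ 0#
  unitOrOne≉0 x with x ≟ 0#
  ... | yes _   = 1≉0
  ... | no  x≉0 = x≉0

  unitOrOne-cong : ∀ {x y} → x ≈ y → unitOrOne x ≈ unitOrOne y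
  unitOrOne-cong {x} {y} x≈y = by-cases (y ≟ 0#)
    where
      by-cases : Dec (y ≈ 0#) → unitOrOne x ≈ unitOrOne y
      by-cases (yes y≈0) = trans (unitOrOne-zero (trans x≈y y≈0)) (sym (unitOrOne-zero y≈0))
      by-cases (no  y≉0) = trans (unitOrOne-unit (λ x≈0 → y≉0 (trans (sym x≈y) x≈0)))
                                 (trans x≈y (sym (unitOrOne-unit y≉0)))

  productOver-unitOrOne-scale : ∀ {a} → ¬ a ≈ 0# → ∀ (ks : List (Fin q)) →
    productOver ks (λ k → unitOrOne (a * enum k))
      ≈ a ^ List.length (List.filter isUnit? ks) * productOver ks (unitOrOne ∘ enum)
  productOver-unitOrOne-scale a≉0 [] = sym (*-identityˡ 1#)
  productOver-unitOrOne-scale {a} a≉0 (k ∷ ks) = by-cases (enum k ≟ 0#)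
    where
      P : Carrier
      P = productOver ks (unitOrOne ∘ enum)

      n : ℕ
      n = List.length (List.filter isUnit? ks)

      ih : productOver ks (λ k → unitOrOne (a * enum k)) ≈ a ^ n * P
      ih = productOver-unitOrOne-scale a≉0 ks

      by-cases : Dec (enum k ≈ 0#) →
                 unitOrOne (a * enum k) * productOver ks (λ k → unitOrOne (a * enum k))
                   ≈ a ^ List.length (List.filter isUnit? (k ∷ ks)) * (unitOrOne (enum k) * P)
      by-cases (yes k↦0) = begin
        unitOrOne (a * enum k) * productOver ks (λ k → unitOrOne (a * enum k))
          ≈⟨ *-cong (unitOrOne-zero (trans (*-congˡ k↦0) (zeroʳ a))) ih ⟩
        1# * (a ^ n * P)
          ≈⟨ *-identityˡ _ ⟩
        a ^ n * P
          ≈⟨ *-cong (sym (^-congʳ a (≡.cong List.length (List.filter-reject isUnit? (λ k≉0 → k≉0 k↦0)))))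
                    (trans (sym (*-identityˡ P)) (*-congʳ (sym (unitOrOne-zero k↦0)))) ⟩
        a ^ List.length (List.filter isUnit? (k ∷ ks)) * (unitOrOne (enum k) * P) ∎
      by-cases (no k≉0) = begin
        unitOrOne (a * enum k) * productOver ks (λ k → unitOrOne (a * enum k))
          ≈⟨ *-cong (unitOrOne-unit (λ ak↦0 → k≉0 (zero-product ak↦0 a≉0))) ih ⟩
        a * enum k * (a ^ n * P)
          ≈⟨ *-interchange _ _ _ _ ⟩
        a * a ^ n * (enum k * P)
          ≈⟨ *-cong (sym (^-congʳ a (≡.cong List.length (List.filter-accept isUnit? k≉0))))
                    (*-congʳ (sym (unitOrOne-unit k≉0))) ⟩
        a ^ List.length (List.filter isUnit? (k ∷ ks)) * (unitOrOne (enum k) * P) ∎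

  productOver-nonzero : ∀ (ks : List (Fin q)) {f} → (∀ k → ¬ f k ≈ 0#) → ¬ productOver ks f ≈ 0#
  productOver-nonzero []       f≉0 = 1≉0
  productOver-nonzero (k ∷ ks) f≉0 fks≈0 = productOver-nonzero ks f≉0 (zero-product fks≈0 (f≉0 k))

  fermat : ∀ {a} → ¬ a ≈ 0# → a ^ unitCount ≈ 1#
  fermat {a} a≉0 with inverse a a≉0
  ... | a⁻¹ , aa⁻¹≈1 = *-cancelˡ Π≉0 (begin
    Π * a ^ unitCount                                    ≈⟨ *-comm _ _ ⟩
    a ^ unitCount * Π                                    ≈⟨ productOver-unitOrOne-scale a≉0 (List.allFin q) ⟨
    productOver (List.allFin q) (λ k → unitOrOne (a * enum k))
      ≈⟨ Scale.sumOver-reindex unitOrOne unitOrOne-cong ⟩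
    Π                                                    ≈⟨ *-identityʳ Π ⟨
    Π * 1#                                               ∎)
    where
      Π : Carrier
      Π = productOver (List.allFin q) (unitOrOne ∘ enum)

      Π≉0 : ¬ Π ≈ 0#
      Π≉0 = productOver-nonzero (List.allFin q) (unitOrOne≉0 ∘ enum)

      module Scale = Reindex *-commutativeMonoid (a *_) (a⁻¹ *_) *-congˡ *-congˡ
        (λ x → trans (sym (*-assoc _ _ _)) (trans (*-congʳ aa⁻¹≈1) (*-identityˡ x)))
        (λ x → trans (sym (*-assoc _ _ _)) (trans (*-congʳ (trans (*-comm _ _) aa⁻¹≈1)) (*-identityˡ x)))

  zeroIndicator : Carrier → Carrier
  zeroIndicator x = 1# - x ^ unitCount

  zeroIndicator-zero : ∀ {x} → x ≈ 0# → zeroIndicator x ≈ 1#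
  zeroIndicator-zero {x} x≈0 = begin
    1# - x ^ unitCount   ≈⟨ +-congˡ (-‿cong (trans (^-congˡ unitCount x≈0) (0^pos 0<unitCount))) ⟩
    1# - 0#              ≈⟨ +-congˡ -0#≈0# ⟩
    1# + 0#              ≈⟨ +-identityʳ 1# ⟩
    1#                   ∎
    where
      0^pos : ∀ {n} → 0 < n → 0# ^ n ≈ 0#
      0^pos {suc n} _ = zeroˡ _

  zeroIndicator-unit : ∀ {x} → ¬ x ≈ 0# → zeroIndicator x ≈ 0#
  zeroIndicator-unit x≉0 = trans (+-congˡ (-‿cong (fermat x≉0))) (-‿inverseʳ 1#)

  -- Polynomials as unnormalised lists of (coefficient, exponent vector) terms: unlike
  -- MPoly, repeated exponents and zero coefficients are allowed, so products need no
  -- normalisation.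
  Term : ℕ → Set c
  Term n = Carrier Prod.× Vec ℕ n

  evalTerm : ∀ {n} → Term n → Vec Carrier n → Carrier
  evalTerm (a , m) xs = a * monomial F m xs

  evalTerms : ∀ {n} → List (Term n) → Vec Carrier n → Carrier
  evalTerms ts xs = sumOver ts (λ t → evalTerm t xs)

  oneᵀ : ∀ {n} → List (Term n)
  oneᵀ {n} = (1# , Vec.replicate n 0) ∷ []

  -ᵀ_ : ∀ {n} → List (Term n) → List (Term n)
  -ᵀ_ = List.map (Prod.map₁ (λ a → - a))

  _·_ : ∀ {n} → Term n → Term n → Term n
  (a , m) · (b , m′) = a * b , Vec.zipWith ℕ._+_ m m′

  _*ᵀ_ : ∀ {n} → List (Term n) → List (Term n) → List (Term n)
  ts *ᵀ us = List.concatMap (λ t → List.map (t ·_) us) ts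

  _^ᵀ_ : ∀ {n} → List (Term n) → ℕ → List (Term n)
  ts ^ᵀ zero  = oneᵀ
  ts ^ᵀ suc k = ts *ᵀ (ts ^ᵀ k)

  monomial-replicate-0 : ∀ {n} (xs : Vec Carrier n) → monomial F (Vec.replicate n 0) xs ≈ 1#
  monomial-replicate-0 []       = refl
  monomial-replicate-0 (x ∷ xs) = trans (*-identityˡ _) (monomial-replicate-0 xs)

  monomial-+ : ∀ {n} (m m′ : Vec ℕ n) xs →
               monomial F (Vec.zipWith ℕ._+_ m m′) xs ≈ monomial F m xs * monomial F m′ xs
  monomial-+ []       []         []       = sym (*-identityˡ 1#)
  monomial-+ (i ∷ m) (j ∷ m′) (x ∷ xs) =
    trans (*-cong (pow-homo-+ x i j) (monomial-+ m m′ xs)) (*-interchange _ _ _ _)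

  evalTerm-· : ∀ {n} (t u : Term n) xs → evalTerm (t · u) xs ≈ evalTerm t xs * evalTerm u xs
  evalTerm-· (a , m) (b , m′) xs = trans (*-congˡ (monomial-+ m m′ xs)) (*-interchange _ _ _ _)

  evalTerms-oneᵀ : ∀ {n} (xs : Vec Carrier n) → evalTerms oneᵀ xs ≈ 1#
  evalTerms-oneᵀ xs = trans (+-identityʳ _) (trans (*-identityˡ _) (monomial-replicate-0 xs))

  evalTerms-negᵀ : ∀ {n} (ts : List (Term n)) xs → evalTerms (-ᵀ ts) xs ≈ - evalTerms ts xs
  evalTerms-negᵀ []       xs = sym -0#≈0#
  evalTerms-negᵀ (t ∷ ts) xs =
    trans (+-cong (sym (-‿distribˡ-* _ _)) (evalTerms-negᵀ ts xs)) (-‿+-comm _ _)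

  evalTerms-*ᵀ : ∀ {n} (ts us : List (Term n)) xs → evalTerms (ts *ᵀ us) xs ≈ evalTerms ts xs * evalTerms us xs
  evalTerms-*ᵀ ts us xs = begin
    evalTerms (ts *ᵀ us) xs                                        ≈⟨ sumOver-concatMap _ ts _ ⟩
    sumOver ts (λ t → sumOver (List.map (t ·_) us) (λ v → evalTerm v xs))
      ≈⟨ sumOver-cong ts (λ t → reflexive (sumOver-map (t ·_) us _)) ⟩
    sumOver ts (λ t → sumOver us (λ u → evalTerm (t · u) xs))
      ≈⟨ sumOver-cong ts (λ t → sumOver-cong us (λ u → evalTerm-· t u xs)) ⟩
    sumOver ts (λ t → sumOver us (λ u → evalTerm t xs * evalTerm u xs))
      ≈⟨ sumOver-cong ts (λ t → sumOver-*ˡ us (evalTerm t xs) _) ⟩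
    sumOver ts (λ t → evalTerm t xs * evalTerms us xs)             ≈⟨ sumOver-*ʳ ts _ _ ⟩
    evalTerms ts xs * evalTerms us xs                              ∎

  evalTerms-^ᵀ : ∀ {n} (ts : List (Term n)) k xs → evalTerms (ts ^ᵀ k) xs ≈ evalTerms ts xs ^ k
  evalTerms-^ᵀ ts zero    xs = evalTerms-oneᵀ xs
  evalTerms-^ᵀ ts (suc k) xs = trans (evalTerms-*ᵀ ts (ts ^ᵀ k) xs) (*-congˡ (evalTerms-^ᵀ ts k xs))

  DegreeI≤ : ∀ {n} → Subset n → ℕ → List (Term n) → Set c
  DegreeI≤ I d ts = All (λ t → degIMono I (proj₂ t) ≤ d) ts

  module _ {n} (I : Subset n) where

    degree-oneᵀ : ∀ d → DegreeI≤ I d oneᵀ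
    degree-oneᵀ d = ≡.subst (_≤ d) (≡.sym (degIMono-replicate-0 I)) z≤n ∷ []

    degree-negᵀ : ∀ {d ts} → DegreeI≤ I d ts → DegreeI≤ I d (-ᵀ ts)
    degree-negᵀ = All.map⁺

    degree-· : ∀ {d d′} (t u : Term n) → degIMono I (proj₂ t) ≤ d → degIMono I (proj₂ u) ≤ d′ →
               degIMono I (proj₂ (t · u)) ≤ d ℕ.+ d′
    degree-· (_ , m) (_ , m′) m≤d m′≤d′ =
      ≡.subst (_≤ _) (≡.sym (degIMono-zipWith-+ I m m′)) (ℕ.+-mono-≤ m≤d m′≤d′)

    degree-*ᵀ : ∀ {d d′ ts us} → DegreeI≤ I d ts → DegreeI≤ I d′ us → DegreeI≤ I (d ℕ.+ d′) (ts *ᵀ us)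
    degree-*ᵀ degts degus = All.concat⁺ (All.map⁺ (All.map
      (λ {t} t≤d → All.map⁺ (All.map (λ {u} → degree-· t u t≤d) degus)) degts))

    degree-^ᵀ : ∀ {d ts} k → DegreeI≤ I d ts → DegreeI≤ I (k ℕ.* d) (ts ^ᵀ k)
    degree-^ᵀ zero    _     = degree-oneᵀ 0
    degree-^ᵀ (suc k) degts = degree-*ᵀ degts (degree-^ᵀ k degts)

    degree-terms : ∀ (P : MPoly F n) → DegreeI≤ I (degI F I P) (terms P)
    degree-terms P = go (terms P)
      where
        go : ∀ ts → DegreeI≤ I (List.foldr (λ t acc → degIMono I (proj₂ t) ℕ.⊔ acc) 0 ts) ts
        go []       = []
        go (t ∷ ts) = ℕ.m≤m⊔n _ _ ∷ All.map (λ t≤ → ℕ.≤-trans t≤ (ℕ.m≤n⊔m _ _)) (go ts)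

  zeroIndicatorᵀ : ∀ {n} → List (Term n) → List (Term n)
  zeroIndicatorᵀ ts = oneᵀ ++ -ᵀ (ts ^ᵀ unitCount)

  commonZeroIndicatorᵀ : ∀ {n r} → (Fin r → MPoly F n) → List (Term n)
  commonZeroIndicatorᵀ {r = zero}  Ps = oneᵀ
  commonZeroIndicatorᵀ {r = suc r} Ps = zeroIndicatorᵀ (terms (Ps zero)) *ᵀ commonZeroIndicatorᵀ (Ps ∘ suc)

  evalTerms-zeroIndicatorᵀ : ∀ {n} (ts : List (Term n)) xs →
                             evalTerms (zeroIndicatorᵀ ts) xs ≈ zeroIndicator (evalTerms ts xs)
  evalTerms-zeroIndicatorᵀ ts xs = trans (sumOver-++ oneᵀ (-ᵀ (ts ^ᵀ unitCount)) (λ t → evalTerm t xs))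
    (+-cong (evalTerms-oneᵀ xs) (trans (evalTerms-negᵀ (ts ^ᵀ unitCount) xs) (-‿cong (evalTerms-^ᵀ ts unitCount xs))))

  degree-zeroIndicatorᵀ : ∀ {n} (I : Subset n) {d} {ts : List (Term n)} →
                          DegreeI≤ I d ts → DegreeI≤ I (unitCount ℕ.* d) (zeroIndicatorᵀ ts)
  degree-zeroIndicatorᵀ I degts = All.++⁺ (degree-oneᵀ I _) (degree-negᵀ I (degree-^ᵀ I unitCount degts))

  evalTerms-commonZeroIndicatorᵀ : ∀ {n r} (Ps : Fin r → MPoly F n) xs →
    evalTerms (commonZeroIndicatorᵀ Ps) xs ≈ ∏ (λ j → zeroIndicator (evalM F (Ps j) xs))
  evalTerms-commonZeroIndicatorᵀ {r = zero}  Ps xs = evalTerms-oneᵀ xs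
  evalTerms-commonZeroIndicatorᵀ {r = suc r} Ps xs =
    trans (evalTerms-*ᵀ (zeroIndicatorᵀ (terms (Ps zero))) (commonZeroIndicatorᵀ (Ps ∘ suc)) xs)
          (*-cong (evalTerms-zeroIndicatorᵀ (terms (Ps zero)) xs) (evalTerms-commonZeroIndicatorᵀ (Ps ∘ suc) xs))

  degree-commonZeroIndicatorᵀ : ∀ {n r} (I : Subset n) (Ps : Fin r → MPoly F n) →
    DegreeI≤ I (unitCount ℕ.* sumFin r (λ j → degI F I (Ps j))) (commonZeroIndicatorᵀ Ps)
  degree-commonZeroIndicatorᵀ {r = zero}  I Ps = degree-oneᵀ I _
  degree-commonZeroIndicatorᵀ {r = suc r} I Ps =
    ≡.subst (λ d → DegreeI≤ I d (commonZeroIndicatorᵀ Ps))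
      (≡.sym (ℕ.*-distribˡ-+ unitCount (degI F I (Ps zero)) _))
      (degree-*ᵀ I (degree-zeroIndicatorᵀ I (degree-terms I (Ps zero))) (degree-commonZeroIndicatorᵀ I (Ps ∘ suc)))

  values : ∀ {n} → Vec (UPoly F) n → Vec (Fin q) n → Vec Carrier n
  values fs k = Vec.zipWith (λ f x → evalU F f (enum x)) fs k

  gridSum : ∀ {n} → Vec (UPoly F) n → (Vec Carrier n → Carrier) → Carrier
  gridSum {n} fs g = sumOver (allVecs F n) (g ∘ values fs)

  gridSum-monomial : ∀ {n} f (fs : Vec (UPoly F) n) m ms →
    gridSum (f ∷ fs) (monomial F (m ∷ ms)) ≈ PowerSum F f m * gridSum fs (monomial F ms)
  gridSum-monomial {n} f fs m ms = begin
    gridSum (f ∷ fs) (monomial F (m ∷ ms))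
      ≈⟨ sumOver-concatMap (λ k → List.map (k ∷_) (allVecs F n)) (List.allFin q) _ ⟩
    sumOver (List.allFin q) (λ k → sumOver (List.map (k ∷_) (allVecs F n)) (monomial F (m ∷ ms) ∘ values (f ∷ fs)))
      ≈⟨ sumOver-cong (List.allFin q) (λ k → reflexive (sumOver-map (k ∷_) (allVecs F n) _)) ⟩
    sumOver (List.allFin q) (λ k → sumOver (allVecs F n) (λ ks → y k * monomial F ms (values fs ks)))
      ≈⟨ sumOver-cong (List.allFin q) (λ k → sumOver-*ˡ (allVecs F n) (y k) _) ⟩
    sumOver (List.allFin q) (λ k → y k * gridSum fs (monomial F ms))
      ≈⟨ sumOver-*ʳ (List.allFin q) _ y ⟩
    PowerSum F f m * gridSum fs (monomial F ms)
      ∎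
    where
      y : Fin q → Carrier
      y k = pow F (evalU F f (enum k)) m

  -- The power sum of exponent 0 counts the elements of F, hence vanishes as well.
  PowerSum-vanishes : ∀ {f u} m → IsU F f u → m <∞ u → PowerSum F f m ≈ 0#
  PowerSum-vanishes zero _ _ =
    trans (reflexive (≡.trans (sumOver-const (List.allFin q) 1#) (≡.cong (_× 1#) length-allFin))) q×1≈0
  PowerSum-vanishes {u = fin δ} (suc m) (_ , _ , below-δ) m<δ = below-δ (suc m) (s≤s z≤n) m<δ
  PowerSum-vanishes {u = ∞}     (suc m) all-vanish        _   = all-vanish (suc m) (s≤s z≤n)

  gridSum-monomial-vanishes : ∀ {n} (I : Subset n) fs us → (∀ i → IsU F (lookup fs i) (lookup us i)) →
    ∀ ms → degIMono I ms <∞ sumUI I us → gridSum fs (monomial F ms) ≈ 0#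
  gridSum-monomial-vanishes []      []       []       _   []       ()
  gridSum-monomial-vanishes (b ∷ I) (f ∷ fs) (u ∷ us) isU (m ∷ ms) deg<u
    with +∞-<∞-split (if b then m else 0) (degIMono I ms) (if b then u else fin 0) (sumUI I us) deg<u
  ... | inj₂ rest<U = trans (gridSum-monomial f fs m ms)
    (trans (*-congˡ (gridSum-monomial-vanishes I fs us (isU ∘ suc) ms rest<U)) (zeroʳ _))
  ... | inj₁ m<u with b
  ...   | true  = trans (gridSum-monomial f fs m ms)
    (trans (*-congʳ (PowerSum-vanishes m (isU zero) m<u)) (zeroˡ _))
  ...   | false with () ← m<u

  gridSum-evalTerms-vanishes : ∀ {n} (I : Subset n) fs us → (∀ i → IsU F (lookup fs i) (lookup us i)) →
    ∀ {d} ts → DegreeI≤ I d ts → d <∞ sumUI I us → gridSum fs (evalTerms ts) ≈ 0#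
  gridSum-evalTerms-vanishes {n} I fs us isU ts degts d<u = begin
    gridSum fs (evalTerms ts)
      ≈⟨ sumOver-comm (allVecs F n) ts (λ k t → evalTerm t (values fs k)) ⟩
    sumOver ts (λ t → sumOver (allVecs F n) (λ k → proj₁ t * monomial F (proj₂ t) (values fs k)))
      ≈⟨ sumOver-cong ts (λ t → sumOver-*ˡ (allVecs F n) (proj₁ t) _) ⟩
    sumOver ts (λ t → proj₁ t * gridSum fs (monomial F (proj₂ t)))
      ≈⟨ sumOver-ε ts (All.map (λ {t} t≤d → trans (*-congˡ (gridSum-monomial-vanishes I fs us isU (proj₂ t)
                                                   (≤-<∞-trans (sumUI I us) t≤d d<u))) (zeroʳ _)) degts) ⟩
    0# ∎

  allZero-indicator : ∀ {r} (v : Fin r → Carrier) → (if allZero F v then 1# else 0#) ≈ ∏ (zeroIndicator ∘ v)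
  allZero-indicator {zero}  v = refl
  allZero-indicator {suc r} v with v zero ≟ 0#
  ... | yes v₀≈0 = trans (allZero-indicator (v ∘ suc))
                         (trans (sym (*-identityˡ _)) (*-congʳ (sym (zeroIndicator-zero v₀≈0))))
  ... | no  v₀≉0 = sym (trans (*-congʳ (zeroIndicator-unit v₀≉0)) (zeroˡ _))

  countZeros-×1 : ∀ {n r} (Ps : Fin r → MPoly F n) fs →
                  countZeros F Ps fs × 1# ≈ gridSum fs (evalTerms (commonZeroIndicatorᵀ Ps))
  countZeros-×1 {n} Ps fs = begin
    countZeros F Ps fs × 1#
      ≈⟨ length-filterᵇ-× (λ k → allZero F (evalsAt k)) (allVecs F n) 1# ⟩
    sumOver (allVecs F n) (λ k → if allZero F (evalsAt k) then 1# else 0#)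
      ≈⟨ sumOver-cong (allVecs F n) (allZero-indicator ∘ evalsAt) ⟩
    sumOver (allVecs F n) (λ k → ∏ (zeroIndicator ∘ evalsAt k))
      ≈⟨ sumOver-cong (allVecs F n) (λ k → sym (evalTerms-commonZeroIndicatorᵀ Ps (values fs k))) ⟩
    gridSum fs (evalTerms (commonZeroIndicatorᵀ Ps))
      ∎
    where
      evalsAt : Vec (Fin q) n → Fin _ → Carrier
      evalsAt k j = evalM F (Ps j) (values fs k)

  countZeros-×1≈0 : ∀ {n r} (Ps : Fin r → MPoly F n) fs (I : Subset n) us →
    (∀ i → IsU F (lookup fs i) (lookup us i)) →
    (q ℕ.∸ 1) ℕ.* sumFin r (λ j → degI F I (Ps j)) <∞ sumUI I us →
    countZeros F Ps fs × 1# ≈ 0#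
  countZeros-×1≈0 {r = r} Ps fs I us isU deg<u = trans (countZeros-×1 Ps fs)
    (gridSum-evalTerms-vanishes I fs us isU (commonZeroIndicatorᵀ Ps) (degree-commonZeroIndicatorᵀ I Ps)
      (≤-<∞-trans (sumUI I us) (ℕ.*-monoˡ-≤ (sumFin r (λ j → degI F I (Ps j))) unitCount≤q∸1) deg<u))

  ×1-homo-^ : ∀ p s → (p ℕ.^ s) × 1# ≈ (p × 1#) ^ s
  ×1-homo-^ p zero    = +-identityʳ 1#
  ×1-homo-^ p (suc s) = trans (×1-homo-* p (p ℕ.^ s)) (*-congˡ (×1-homo-^ p s))

  characteristic-×1≈0 : ∀ {p s} → q ≡ p ℕ.^ s → p × 1# ≈ 0#
  characteristic-×1≈0 {p} {s} ≡.refl = ^≈0⇒≈0 s (trans (sym (×1-homo-^ p s)) q×1≈0)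

  linear-relation-×1≈0 : ∀ d a b c e → d ℕ.+ a ℕ.* b ≡ c ℕ.* e → b × 1# ≈ 0# → e × 1# ≈ 0# → d × 1# ≈ 0#
  linear-relation-×1≈0 d a b c e eq b≈0 e≈0 = begin
    d × 1#                       ≈⟨ +-identityʳ _ ⟨
    d × 1# + 0#                  ≈⟨ +-congˡ (trans (*-congˡ b≈0) (zeroʳ _)) ⟨
    d × 1# + a × 1# * b × 1#     ≈⟨ +-congˡ (×1-homo-* a b) ⟨
    d × 1# + (a ℕ.* b) × 1#      ≈⟨ ×-homo-+ 1# d (a ℕ.* b) ⟨
    (d ℕ.+ a ℕ.* b) × 1#         ≡⟨ ≡.cong (_× 1#) eq ⟩
    (c ℕ.* e) × 1#               ≈⟨ ×1-homo-* c e ⟩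
    c × 1# * e × 1#              ≈⟨ *-congˡ e≈0 ⟩
    c × 1# * 0#                  ≈⟨ zeroʳ _ ⟩
    0#                           ∎

  bézout-×1≈0 : ∀ {d m n} → Bézout.Identity d m n → m × 1# ≈ 0# → n × 1# ≈ 0# → d × 1# ≈ 0#
  bézout-×1≈0 {d} {m} {n} (Bézout.+- x y eq) m≈0 n≈0 = linear-relation-×1≈0 d y n x m eq n≈0 m≈0
  bézout-×1≈0 {d} {m} {n} (Bézout.-+ x y eq) m≈0 n≈0 = linear-relation-×1≈0 d x m y n eq m≈0 n≈0

  -- By Bézout gcd N p is also sent to 0, so it is p rather than 1.
  ×1≈0⇒prime∣ : ∀ {p N} → Prime p → p × 1# ≈ 0# → N × 1# ≈ 0# → p ∣ N
  ×1≈0⇒prime∣ {p} {N} p-prime p≈0 N≈0 with prime⇒irreducible p-prime (gcd[m,n]∣n N p)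
  ... | inj₁ gcd≡1 = ⊥-elim (1≉0 (trans (sym (+-identityʳ 1#))
          (≡.subst (λ g → g × 1# ≈ 0#) gcd≡1 (bézout-×1≈0 (Bézout.identity (gcd-GCD N p)) N≈0 p≈0))))
  ... | inj₂ gcd≡p = ≡.subst (_∣ N) gcd≡p (gcd[m,n]∣m N p)

open import Data.Nat using (_*_; _∸_; _^_)

theorem1p4 : ∀ {c ℓ : Level} {q p s : ℕ} (F : FiniteField c ℓ q) → Prime p → q ≡ p ^ s →
    ∀ {n r : ℕ} (Ps : Fin r → MPoly F n) → (∀ j → NonzeroPoly F (Ps j)) →
    (fs : Vec (UPoly F) n) (I : Subset n) → Nonempty I →
    (us : Vec ℕ∞ n) → (∀ i → IsU F (lookup fs i) (lookup us i)) →
    (q ∸ 1) * sumFin r (λ j → degI F I (Ps j)) <∞ sumUI I us →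
    p ∣ countZeros F Ps fs
theorem1p4 {p = p} {s} F p-prime q≡pˢ Ps _ fs I _ us isU deg<u =
  ×1≈0⇒prime∣ p-prime (characteristic-×1≈0 {p} {s} q≡pˢ) (countZeros-×1≈0 Ps fs I us isU deg<u)
  where open Counting F
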